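{- Let $\mathbb G$ be a graph. If every vertex of $\mathbb G$ has degree at most $k$, where $k\geq 2$, then every element of $\operatorname{Pos}(\mathbb G)$ has at most $k+1$ immediate successors and at most $2k+6$ successors in total.
   Context: Construction: for a graph $\mathbb G=(V,E)$, $\operatorname{Pos}(\mathbb G)$ has carrier $V\cup V_a\cup V_b\cup E_1\cup E_2\cup\{\top_1,\top_2,\infty_a,\infty_b\}$, where $V_a=\{v_a\},V_b=\{v_b\}$ are disjoint copies of $V$, $E_1=\{e_1\},E_2=\{e_2\}$ are disjoint copies of $E$, and the last four elements are new; its order is the reflexive–transitive closure of the covering relation: $v\prec v_a$, $v\prec v_b$, $v_a\prec\infty_a$, $v_b\prec\infty_b$ ($v\in V$); $e_1,e_2\prec\top_1$ and $e_1,e_2\prec\top_2$ ($e\in E$); $v_a,v_b\prec\top_1,\top_2$ for isolated $v$; and for each edge $e=uv$, $u_a,v_b\prec e_i$ and $u_b,v_a\prec e_j$ with $\{i,j\}=\{1,2\}$ (choice of copy arbitrary). An immediate successor of $x$ is an element covering $x$; a successor of $x$ is an element strictly above $x$. -}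

module Defs where

open import Data.Nat using (ℕ; _≤_)
open import Data.Fin using (Fin)
open import Data.Fin.Properties using (_≟_)
open import Data.Product using (_×_; _,_; proj₁; proj₂; Σ; ∃)
open import Data.Sum using (_⊎_)
open import Data.List using (List; length; filter; allFin)
open import Data.List.Relation.Unary.All using (All)
open import Data.List.Relation.Unary.Unique.Propositional using (Unique)
open import Relation.Nullary using (¬_)
open import Relation.Nullary.Decidable using (_⊎-dec_)
open import Relation.Binary.PropositionalEquality using (_≡_; _≢_)
open import Relation.Binary.Construct.Closure.ReflexiveTransitive using (Star)

SameEdge : ∀ {n} → Fin n × Fin n → Fin n × Fin n → Set
SameEdge (u , v) (u' , v') = (u ≡ u' × v ≡ v') ⊎ (u ≡ v' × v ≡ u')

-- Each edge e is
-- given as an ordered pair ends e = (u , v) of its endpoints; the order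
-- of the pair encodes the arbitrary choice of copy in Pos(G)
-- (u_a, v_b ≺ e₁ and u_b, v_a ≺ e₂).
record Graph : Set where
  field
    n m      : ℕ
    ends     : Fin m → Fin n × Fin n
    loopless : ∀ e → proj₁ (ends e) ≢ proj₂ (ends e)
    simple   : ∀ e f → SameEdge (ends e) (ends f) → e ≡ f

module _ (G : Graph) where
  open Graph G

  Incident : Fin n → Fin m → Set
  Incident v e = proj₁ (ends e) ≡ v ⊎ proj₂ (ends e) ≡ v

  degree : Fin n → ℕ
  degree v = length (filter (λ e → (proj₁ (ends e) ≟ v) ⊎-dec (proj₂ (ends e) ≟ v)) (allFin m))

  Isolated : Fin n → Set
  Isolated v = ∀ e → ¬ Incident v e

module Pos (G : Graph) where
  open Graph G

  data Elem : Set where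
    vtx va vb : Fin n → Elem
    e₁ e₂     : Fin m → Elem
    top₁ top₂ inf-a inf-b : Elem

  data _≺_ : Elem → Elem → Set where
    v≺va   : ∀ v → vtx v ≺ va v
    v≺vb   : ∀ v → vtx v ≺ vb v
    va≺∞a  : ∀ v → va v ≺ inf-a
    vb≺∞b  : ∀ v → vb v ≺ inf-b
    e₁≺⊤₁  : ∀ e → e₁ e ≺ top₁
    e₁≺⊤₂  : ∀ e → e₁ e ≺ top₂
    e₂≺⊤₁  : ∀ e → e₂ e ≺ top₁
    e₂≺⊤₂  : ∀ e → e₂ e ≺ top₂
    isoa≺⊤₁ : ∀ v → Isolated G v → va v ≺ top₁
    isoa≺⊤₂ : ∀ v → Isolated G v → va v ≺ top₂
    isob≺⊤₁ : ∀ v → Isolated G v → vb v ≺ top₁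
    isob≺⊤₂ : ∀ v → Isolated G v → vb v ≺ top₂
    ua≺e₁  : ∀ e → va (proj₁ (ends e)) ≺ e₁ e
    vb≺e₁  : ∀ e → vb (proj₂ (ends e)) ≺ e₁ e
    ub≺e₂  : ∀ e → vb (proj₁ (ends e)) ≺ e₂ e
    va≺e₂  : ∀ e → va (proj₂ (ends e)) ≺ e₂ e

  _≤P_ : Elem → Elem → Set
  x ≤P y = Star _≺_ x y

  _<P_ : Elem → Elem → Set
  x <P y = x ≤P y × x ≢ y

  Successor : Elem → Elem → Set
  Successor x y = x <P y

  ImmediateSuccessor : Elem → Elem → Set
  ImmediateSuccessor x y = x <P y × ¬ (∃ λ z → x <P z × z <P y)

  AtMost : ℕ → (Elem → Set) → Set
  AtMost c P = ∀ (ys : List Elem) → Unique ys → All P ys → length ys ≤ c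

-- The order is the reflexive–transitive closure of the covering relation ≺, and ≺ strictly raises a
-- rank function, so a chain of two or more ≺-steps is never a covering pair: the immediate
-- successors of x are exactly its ≺-covers.  Above v_a lie ∞_a and one copy of each edge at v (or
-- ⊤_1, ⊤_2 if v is isolated), at most max(2, deg v) + 1 ≤ k + 1 covers; everything above v lies among
-- v_a, v_b, ∞_a, ∞_b, ⊤_1, ⊤_2 and both copies of each edge at v, at most 2k + 6 elements.
module Submission where

open import Defs
open import Data.Nat using (ℕ; _≤_; _<_; _+_; _*_; suc; z≤n; s≤s)
open import Data.Nat.Properties using (≤-refl; ≤-trans; ≤-reflexive; <⇒≤; <-≤-trans; <⇒≢; n≤1+n; m≤m+n; +-mono-≤; +-monoʳ-≤; +-comm)
open import Data.Bool using (if_then_else_)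
open import Data.Product using (_×_; _,_; proj₁; proj₂; ∃)
open import Data.Sum using (inj₁; inj₂)
open import Data.Empty using (⊥-elim)
open import Data.Fin using (Fin)
open import Data.Fin.Properties using (_≟_)
open import Data.List using (List; []; _∷_; length; map; filter; allFin; _++_)
open import Data.List.Properties using (length-map; length-++; length-removeAt′; filter-none)
open import Data.List.Membership.Propositional using (_∈_; _─_)
open import Data.List.Membership.Propositional.Properties using (∈-map⁺; ∈-filter⁺; ∈-allFin)
open import Data.List.Relation.Binary.Subset.Propositional using (_⊆_)
open import Data.List.Relation.Binary.Subset.Propositional.Properties using (⊆-refl; ⊆-trans; xs⊆x∷xs; xs⊆xs++ys; xs⊆ys++xs; ++⁺ʳ)
open import Data.List.Relation.Unary.Any using (here; there; index)
open import Data.List.Relation.Unary.All as All using (All)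
open import Data.List.Relation.Unary.AllPairs using (_∷_)
open import Data.List.Relation.Unary.Unique.Propositional using (Unique)
open import Relation.Nullary using (¬_; Dec; does)
open import Relation.Nullary.Decidable using (_⊎-dec_; dec-true; dec-false)
open import Relation.Binary.PropositionalEquality using (_≡_; _≢_; refl; sym; cong; subst; ≢-sym)
open import Relation.Binary.Construct.Closure.ReflexiveTransitive using (Star; ε; _◅_)

module _ {A : Set} where

  ∈-─⁺ : ∀ {x y} {xs : List A} (x∈xs : x ∈ xs) → y ∈ xs → y ≢ x → y ∈ xs ─ x∈xs
  ∈-─⁺ (here refl) (here refl) y≢x = ⊥-elim (y≢x refl)
  ∈-─⁺ (here _)    (there y∈xs) _ = y∈xs
  ∈-─⁺ (there _)   (here refl) _ = here refl
  ∈-─⁺ (there x∈xs) (there y∈xs) y≢x = there (∈-─⁺ x∈xs y∈xs y≢x)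

  unique-⊆⇒length≤ : ∀ {xs ys : List A} → Unique ys → ys ⊆ xs → length ys ≤ length xs
  unique-⊆⇒length≤ {ys = []} _ _ = z≤n
  unique-⊆⇒length≤ {xs} {y ∷ ys} (y∉ys ∷ unique) ys⊆xs =
    subst (suc (length ys) ≤_) (sym (length-removeAt′ xs (index y∈xs)))
      (s≤s (unique-⊆⇒length≤ unique λ z∈ys →
        ∈-─⁺ y∈xs (ys⊆xs (there z∈ys)) (≢-sym (All.lookup y∉ys z∈ys))))
    where
    y∈xs : y ∈ xs
    y∈xs = ys⊆xs (here refl)

  unique-all⇒length≤ : ∀ {P : A → Set} {c} (xs : List A) → (∀ {y} → P y → y ∈ xs) → length xs ≤ c →
                       ∀ ys → Unique ys → All P ys → length ys ≤ c
  unique-all⇒length≤ xs P⇒∈ |xs|≤c ys unique all-P =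
    ≤-trans (unique-⊆⇒length≤ unique (λ y∈ys → P⇒∈ (All.lookup all-P y∈ys))) |xs|≤c

  _orElse_ : List A → List A → List A
  []       orElse ys = ys
  (x ∷ xs) orElse _  = x ∷ xs

  orElse-⊆-++ : ∀ (xs ys : List A) → xs orElse ys ⊆ ys ++ xs
  orElse-⊆-++ []       ys = xs⊆xs++ys ys []
  orElse-⊆-++ (x ∷ xs) ys = xs⊆ys++xs (x ∷ xs) ys

  ⊆-orElse : ∀ (xs ys : List A) → xs ⊆ xs orElse ys
  ⊆-orElse (_ ∷ _) _ x∈xs = x∈xs

  length-orElse≤ : ∀ {xs ys : List A} {c} → length xs ≤ c → length ys ≤ c → length (xs orElse ys) ≤ c
  length-orElse≤ {[]}    _ |ys|≤c = |ys|≤c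
  length-orElse≤ {_ ∷ _} |xs|≤c _ = |xs|≤c

module _ {A : Set} {_≺_ : A → A → Set} (rank : A → ℕ) (rank-mono : ∀ {x y} → x ≺ y → rank x < rank y) where

  rank-mono⋆ : ∀ {x y} → Star _≺_ x y → rank x ≤ rank y
  rank-mono⋆ ε       = ≤-refl
  rank-mono⋆ (p ◅ s) = ≤-trans (<⇒≤ (rank-mono p)) (rank-mono⋆ s)

  ≺◅⋆⇒≢ : ∀ {x y z} → x ≺ y → Star _≺_ y z → x ≢ z
  ≺◅⋆⇒≢ p s x≡z = <⇒≢ (<-≤-trans (rank-mono p) (rank-mono⋆ s)) (cong rank x≡z)

  covering⇒≺ : ∀ {x y} → Star _≺_ x y → x ≢ y →
               ¬ (∃ λ z → (Star _≺_ x z × x ≢ z) × (Star _≺_ z y × z ≢ y)) → x ≺ y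
  covering⇒≺ ε           x≢x _ = ⊥-elim (x≢x refl)
  covering⇒≺ (p ◅ ε)     _   _ = p
  covering⇒≺ (p ◅ q ◅ s) _   nothing-between =
    ⊥-elim (nothing-between (_ , (p ◅ ε , ≺◅⋆⇒≢ p ε) , (q ◅ s , ≺◅⋆⇒≢ q s)))

module _ {A : Set} {_≺_ : A → A → Set} (above : A → List A)
         (≺⇒∈ : ∀ {x y} → x ≺ y → y ∈ above x) (≺⇒⊇ : ∀ {x y} → x ≺ y → above y ⊆ above x) where

  ≺◅⋆⇒∈ : ∀ {x y z} → x ≺ y → Star _≺_ y z → z ∈ above x
  ≺◅⋆⇒∈ p ε       = ≺⇒∈ p
  ≺◅⋆⇒∈ p (q ◅ s) = ≺⇒⊇ p (≺◅⋆⇒∈ q s)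

  strict⋆⇒∈ : ∀ {x y} → Star _≺_ x y → x ≢ y → y ∈ above x
  strict⋆⇒∈ ε       x≢x = ⊥-elim (x≢x refl)
  strict⋆⇒∈ (p ◅ s) _   = ≺◅⋆⇒∈ p s

module PosCounting (G : Graph) where
  open Graph G
  open Pos G

  rank : Elem → ℕ
  rank (vtx _) = 0
  rank (va _)  = 1
  rank (vb _)  = 1
  rank (e₁ _)  = 2
  rank (e₂ _)  = 2
  rank inf-a   = 2
  rank inf-b   = 2
  rank top₁    = 3
  rank top₂    = 3

  ≺⇒rank< : ∀ {x y} → x ≺ y → rank x < rank y
  ≺⇒rank< (v≺va _)      = s≤s z≤n
  ≺⇒rank< (v≺vb _)      = s≤s z≤n
  ≺⇒rank< (va≺∞a _)     = s≤s (s≤s z≤n)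
  ≺⇒rank< (vb≺∞b _)     = s≤s (s≤s z≤n)
  ≺⇒rank< (e₁≺⊤₁ _)     = s≤s (s≤s (s≤s z≤n))
  ≺⇒rank< (e₁≺⊤₂ _)     = s≤s (s≤s (s≤s z≤n))
  ≺⇒rank< (e₂≺⊤₁ _)     = s≤s (s≤s (s≤s z≤n))
  ≺⇒rank< (e₂≺⊤₂ _)     = s≤s (s≤s (s≤s z≤n))
  ≺⇒rank< (isoa≺⊤₁ _ _) = s≤s (s≤s z≤n)
  ≺⇒rank< (isoa≺⊤₂ _ _) = s≤s (s≤s z≤n)
  ≺⇒rank< (isob≺⊤₁ _ _) = s≤s (s≤s z≤n)
  ≺⇒rank< (isob≺⊤₂ _ _) = s≤s (s≤s z≤n)
  ≺⇒rank< (ua≺e₁ _)     = s≤s (s≤s z≤n)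
  ≺⇒rank< (vb≺e₁ _)     = s≤s (s≤s z≤n)
  ≺⇒rank< (ub≺e₂ _)     = s≤s (s≤s z≤n)
  ≺⇒rank< (va≺e₂ _)     = s≤s (s≤s z≤n)

  immediateSuccessor⇒≺ : ∀ {x y} → ImmediateSuccessor x y → x ≺ y
  immediateSuccessor⇒≺ ((x≤y , x≢y) , nothing-between) = covering⇒≺ rank ≺⇒rank< x≤y x≢y nothing-between

  incident? : ∀ v e → Dec (Incident G v e)
  incident? v e = (proj₁ (ends e) ≟ v) ⊎-dec (proj₂ (ends e) ≟ v)

  incident : Fin n → List (Fin m)
  incident v = filter (incident? v) (allFin m)

  isolated⇒incident≡[] : ∀ {v} → Isolated G v → incident v ≡ []
  isolated⇒incident≡[] {v} isolated = filter-none (incident? v) {allFin m} (All.tabulate λ {e} _ → isolated e)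

  -- Meaningful only for e incident to v: the copy of e above v_a, and the one above v_b.
  copyAboveA copyAboveB : Fin n → Fin m → Elem
  copyAboveA v e = if does (proj₁ (ends e) ≟ v) then e₁ e else e₂ e
  copyAboveB v e = if does (proj₁ (ends e) ≟ v) then e₂ e else e₁ e

  edgesAboveA edgesAboveB : Fin n → List Elem
  edgesAboveA v = map (copyAboveA v) (incident v)
  edgesAboveB v = map (copyAboveB v) (incident v)

  module _ (e : Fin m) where
    private
      u = proj₁ (ends e)
      w = proj₂ (ends e)

      u∈incident : e ∈ incident u
      u∈incident = ∈-filter⁺ (incident? u) (∈-allFin e) (inj₁ refl)

      w∈incident : e ∈ incident w
      w∈incident = ∈-filter⁺ (incident? w) (∈-allFin e) (inj₂ refl)

      copyAboveA-u : copyAboveA u e ≡ e₁ e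
      copyAboveA-u rewrite dec-true (u ≟ u) refl = refl

      copyAboveB-u : copyAboveB u e ≡ e₂ e
      copyAboveB-u rewrite dec-true (u ≟ u) refl = refl

      copyAboveA-w : copyAboveA w e ≡ e₂ e
      copyAboveA-w rewrite dec-false (u ≟ w) (loopless e) = refl

      copyAboveB-w : copyAboveB w e ≡ e₁ e
      copyAboveB-w rewrite dec-false (u ≟ w) (loopless e) = refl

    e₁∈edgesAboveA : e₁ e ∈ edgesAboveA u
    e₁∈edgesAboveA = subst (_∈ edgesAboveA u) copyAboveA-u (∈-map⁺ (copyAboveA u) u∈incident)

    e₂∈edgesAboveB : e₂ e ∈ edgesAboveB u
    e₂∈edgesAboveB = subst (_∈ edgesAboveB u) copyAboveB-u (∈-map⁺ (copyAboveB u) u∈incident)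

    e₂∈edgesAboveA : e₂ e ∈ edgesAboveA w
    e₂∈edgesAboveA = subst (_∈ edgesAboveA w) copyAboveA-w (∈-map⁺ (copyAboveA w) w∈incident)

    e₁∈edgesAboveB : e₁ e ∈ edgesAboveB w
    e₁∈edgesAboveB = subst (_∈ edgesAboveB w) copyAboveB-w (∈-map⁺ (copyAboveB w) w∈incident)

  tops : List Elem
  tops = top₁ ∷ top₂ ∷ []

  covers : Elem → List Elem
  covers (vtx v) = va v ∷ vb v ∷ []
  covers (va v)  = inf-a ∷ (edgesAboveA v orElse tops)
  covers (vb v)  = inf-b ∷ (edgesAboveB v orElse tops)
  covers (e₁ _)  = tops
  covers (e₂ _)  = tops
  covers inf-a   = []
  covers inf-b   = []
  covers top₁    = []
  covers top₂    = []

  successors : Elem → List Elem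
  successors (vtx v) = va v ∷ vb v ∷ inf-a ∷ inf-b ∷ tops ++ edgesAboveA v ++ edgesAboveB v
  successors (va v)  = inf-a ∷ tops ++ edgesAboveA v
  successors (vb v)  = inf-b ∷ tops ++ edgesAboveB v
  successors (e₁ _)  = tops
  successors (e₂ _)  = tops
  successors inf-a   = []
  successors inf-b   = []
  successors top₁    = []
  successors top₂    = []

  ≺⇒∈covers : ∀ {x y} → x ≺ y → y ∈ covers x
  ≺⇒∈covers (v≺va _)        = here refl
  ≺⇒∈covers (v≺vb _)        = there (here refl)
  ≺⇒∈covers (va≺∞a _)       = here refl
  ≺⇒∈covers (vb≺∞b _)       = here refl
  ≺⇒∈covers (e₁≺⊤₁ _)       = here refl
  ≺⇒∈covers (e₁≺⊤₂ _)       = there (here refl)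
  ≺⇒∈covers (e₂≺⊤₁ _)       = here refl
  ≺⇒∈covers (e₂≺⊤₂ _)       = there (here refl)
  ≺⇒∈covers (isoa≺⊤₁ _ iso) rewrite isolated⇒incident≡[] iso = there (here refl)
  ≺⇒∈covers (isoa≺⊤₂ _ iso) rewrite isolated⇒incident≡[] iso = there (there (here refl))
  ≺⇒∈covers (isob≺⊤₁ _ iso) rewrite isolated⇒incident≡[] iso = there (here refl)
  ≺⇒∈covers (isob≺⊤₂ _ iso) rewrite isolated⇒incident≡[] iso = there (there (here refl))
  ≺⇒∈covers (ua≺e₁ e)       = there (⊆-orElse _ tops (e₁∈edgesAboveA e))
  ≺⇒∈covers (vb≺e₁ e)       = there (⊆-orElse _ tops (e₁∈edgesAboveB e))
  ≺⇒∈covers (ub≺e₂ e)       = there (⊆-orElse _ tops (e₂∈edgesAboveB e))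
  ≺⇒∈covers (va≺e₂ e)       = there (⊆-orElse _ tops (e₂∈edgesAboveA e))

  covers⊆successors : ∀ x → covers x ⊆ successors x
  covers⊆successors (vtx v) = xs⊆xs++ys (va v ∷ vb v ∷ []) _
  covers⊆successors (va v)  = ++⁺ʳ (inf-a ∷ []) (orElse-⊆-++ (edgesAboveA v) tops)
  covers⊆successors (vb v)  = ++⁺ʳ (inf-b ∷ []) (orElse-⊆-++ (edgesAboveB v) tops)
  covers⊆successors (e₁ _)  = ⊆-refl
  covers⊆successors (e₂ _)  = ⊆-refl
  covers⊆successors inf-a   = ⊆-refl
  covers⊆successors inf-b   = ⊆-refl
  covers⊆successors top₁    = ⊆-refl
  covers⊆successors top₂    = ⊆-refl

  tops⊆ : ∀ x {xs} → tops ⊆ x ∷ tops ++ xs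
  tops⊆ x {xs} = ⊆-trans (xs⊆xs++ys tops xs) (xs⊆x∷xs _ x)

  ≺⇒successors⊇ : ∀ {x y} → x ≺ y → successors y ⊆ successors x
  ≺⇒successors⊇ (v≺va v) (here refl) = there (there (here refl))
  ≺⇒successors⊇ (v≺va v) (there z∈) = there (there (there (there (++⁺ʳ tops (xs⊆xs++ys _ _) z∈))))
  ≺⇒successors⊇ (v≺vb v) (here refl) = there (there (there (here refl)))
  ≺⇒successors⊇ (v≺vb v) (there z∈) = there (there (there (there (++⁺ʳ tops (xs⊆ys++xs _ _) z∈))))
  ≺⇒successors⊇ (va≺∞a _)     ()
  ≺⇒successors⊇ (vb≺∞b _)     ()
  ≺⇒successors⊇ (e₁≺⊤₁ _)     ()
  ≺⇒successors⊇ (e₁≺⊤₂ _)     ()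
  ≺⇒successors⊇ (e₂≺⊤₁ _)     ()
  ≺⇒successors⊇ (e₂≺⊤₂ _)     ()
  ≺⇒successors⊇ (isoa≺⊤₁ _ _) ()
  ≺⇒successors⊇ (isoa≺⊤₂ _ _) ()
  ≺⇒successors⊇ (isob≺⊤₁ _ _) ()
  ≺⇒successors⊇ (isob≺⊤₂ _ _) ()
  ≺⇒successors⊇ (ua≺e₁ _)     = tops⊆ inf-a
  ≺⇒successors⊇ (vb≺e₁ _)     = tops⊆ inf-b
  ≺⇒successors⊇ (ub≺e₂ _)     = tops⊆ inf-b
  ≺⇒successors⊇ (va≺e₂ _)     = tops⊆ inf-a

  successor⇒∈successors : ∀ {x y} → Successor x y → y ∈ successors x
  successor⇒∈successors (x≤y , x≢y) =
    strict⋆⇒∈ successors (λ x≺y → covers⊆successors _ (≺⇒∈covers x≺y)) ≺⇒successors⊇ x≤y x≢y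

  module _ {k : ℕ} (2≤k : 2 ≤ k) (degree≤k : ∀ v → degree G v ≤ k) where

    length-edgesAbove≤ : ∀ {v} (copy : Fin m → Elem) → length (map copy (incident v)) ≤ k
    length-edgesAbove≤ {v} copy = subst (_≤ k) (sym (length-map copy (incident v))) (degree≤k v)

    length-covers≤ : ∀ x → length (covers x) ≤ suc k
    length-covers≤ (vtx _) = ≤-trans 2≤k (n≤1+n k)
    length-covers≤ (va v)  = s≤s (length-orElse≤ {xs = edgesAboveA v} (length-edgesAbove≤ (copyAboveA v)) 2≤k)
    length-covers≤ (vb v)  = s≤s (length-orElse≤ {xs = edgesAboveB v} (length-edgesAbove≤ (copyAboveB v)) 2≤k)
    length-covers≤ (e₁ _)  = ≤-trans 2≤k (n≤1+n k)
    length-covers≤ (e₂ _)  = ≤-trans 2≤k (n≤1+n k)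
    length-covers≤ inf-a   = z≤n
    length-covers≤ inf-b   = z≤n
    length-covers≤ top₁    = z≤n
    length-covers≤ top₂    = z≤n

    length-successors≤ : ∀ x → length (successors x) ≤ 6 + 2 * k
    length-successors≤ (vtx v) = +-monoʳ-≤ 6 (subst (_≤ 2 * k) (sym (length-++ (edgesAboveA v)))
      (+-mono-≤ (length-edgesAbove≤ (copyAboveA v)) (≤-trans (length-edgesAbove≤ (copyAboveB v)) (m≤m+n k 0))))
    length-successors≤ (va v)  = +-mono-≤ (m≤m+n 3 3) (≤-trans (length-edgesAbove≤ (copyAboveA v)) (m≤m+n k _))
    length-successors≤ (vb v)  = +-mono-≤ (m≤m+n 3 3) (≤-trans (length-edgesAbove≤ (copyAboveB v)) (m≤m+n k _))
    length-successors≤ (e₁ _)  = s≤s (s≤s z≤n)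
    length-successors≤ (e₂ _)  = s≤s (s≤s z≤n)
    length-successors≤ inf-a   = z≤n
    length-successors≤ inf-b   = z≤n
    length-successors≤ top₁    = z≤n
    length-successors≤ top₂    = z≤n

lemma9 : (G : Graph) (k : ℕ) → 2 ≤ k
    → (∀ v → degree G v ≤ k)
    → ∀ (x : Pos.Elem G)
    → Pos.AtMost G (suc k) (Pos.ImmediateSuccessor G x)
      × Pos.AtMost G (2 * k + 6) (Pos.Successor G x)
lemma9 G k 2≤k degree≤k x =
  unique-all⇒length≤ (covers x) (λ imm → ≺⇒∈covers (immediateSuccessor⇒≺ imm)) (length-covers≤ 2≤k degree≤k x) ,
  unique-all⇒length≤ (successors x) successor⇒∈successors
    (≤-trans (length-successors≤ 2≤k degree≤k x) (≤-reflexive (+-comm 6 (2 * k))))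
  where open PosCounting G
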